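{- For every positive integer $n$ and every odd prime number $p$, $$\sum_{r=1}^{n} v_2(r)\,v_p(r)\le \sum_{r=1}^{n} v_p(r)-\left\lfloor\frac{\log n}{\log p}\right\rfloor.$$
   Context: For a prime $q$, $v_q$ denotes the $q$-adic valuation; $\lfloor\cdot\rfloor$ is the integer-part (floor) function. -}

module Defs where

open import Data.Nat using (ℕ; zero; suc; _+_; _*_; _≤_; _≤?_; NonZero)
open import Data.Nat.DivMod using (_/_)
open import Data.Nat.Divisibility using (_∣?_)
open import Relation.Nullary using (yes; no)

sumFrom1 : ℕ → (ℕ → ℕ) → ℕ
sumFrom1 zero    f = 0
sumFrom1 (suc n) f = sumFrom1 n f + f (suc n)

-- q-adic valuation with fuel: number of times q divides r
-- (stops when q ∤ r; r = 0 gives 0, only used for r ≥ 1).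
valAux : (q : ℕ) .{{_ : NonZero q}} → ℕ → ℕ → ℕ
valAux q zero     r = 0
valAux q (suc f) zero = 0
valAux q (suc f) (suc r) with q ∣? suc r
... | yes _ = suc (valAux q f (suc r / q))
... | no  _ = 0

-- v_q(r) for r ≥ 1 and q ≥ 2 (fuel r suffices since r/q < r)
v : (q : ℕ) .{{_ : NonZero q}} → ℕ → ℕ
v q r = valAux q r r

-- ⌊log n / log p⌋ for p ≥ 2, n ≥ 1: the largest k with p^k ≤ n
flogAux : (p : ℕ) .{{_ : NonZero p}} → ℕ → ℕ → ℕ
flogAux p zero    n = 0
flogAux p (suc f) n with p ≤? n
... | yes _ = suc (flogAux p f (n / p))
... | no  _ = 0

flog : (p : ℕ) .{{_ : NonZero p}} → ℕ → ℕ
flog p n = flogAux p n n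

module Submission where

-- Write Σ(n, f) for Σ_{r=1}^{n} f(r), S(n) = Σ(n, v_p) and S₂(n) = Σ(n, v₂·v_p).
-- Only multiples of p contribute to S and S₂, and writing r = s·p gives, for
-- m = ⌊n/p⌋ and p odd,
--     S(n)  = m + S(m)                 (Legendre's recursion: v_p(sp) = 1 + v_p(s)),
--     S₂(n) = Σ(m, v₂) + S₂(m)         (since moreover v₂(sp) = v₂(s)).
-- Legendre's recursion for the prime 2 also gives Σ(m, v₂) < m for m ≥ 1.
-- Finally ⌊log n/log p⌋ = 1 + ⌊log m/log p⌋ when p ≤ n, and = 0 (with m = 0)
-- otherwise.

open import Defs
open import Data.Nat using (ℕ; zero; suc; _+_; _*_; _/_; _%_; _≤_; _<_; _≤?_; z≤n; s≤s; NonZero)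
open import Data.Nat.Base using (>-nonZero; ≢-nonZero)
open import Data.Nat.Properties
open import Data.Nat.DivMod using (m≡m%n+[m/n]*n; m%n<n; m/n<m; m/n*n≤m; m*n/n≡m; m<n⇒m/n≡0; m≥n⇒m/n>0)
open import Data.Nat.Divisibility using (_∣_; _∣?_; divides; _∣0; n∣m*n; ∣m+n∣m⇒∣n; >⇒∤)
open import Data.Nat.Induction using (<-rec)
open import Data.Nat.Primality using (Prime; euclidsLemma; prime[2]; ¬prime[0]; ¬prime[1])
open import Algebra.Properties.CommutativeSemigroup +-commutativeSemigroup using (interchange)
open import Algebra.Properties.CommutativeSemigroup *-commutativeSemigroup using (xy∙z≈xz∙y)
open import Data.Sum using ([_,_])
open import Data.Empty using (⊥-elim)
open import Function.Base using (_∘_)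
open import Relation.Nullary using (¬_; Dec; yes; no)
open import Relation.Binary.PropositionalEquality using (_≡_; refl; sym; trans; cong; cong₂; module ≡-Reasoning)

sum-cong : ∀ n {f g : ℕ → ℕ} → (∀ r → f (suc r) ≡ g (suc r)) →
           sumFrom1 n f ≡ sumFrom1 n g
sum-cong zero    f≗g = refl
sum-cong (suc n) f≗g = cong₂ _+_ (sum-cong n f≗g) (f≗g n)

sum-+ : ∀ n (f g : ℕ → ℕ) →
        sumFrom1 n (λ r → f r + g r) ≡ sumFrom1 n f + sumFrom1 n g
sum-+ zero    f g = refl
sum-+ (suc n) f g = trans (cong (_+ (f (suc n) + g (suc n))) (sum-+ n f g))
                          (interchange (sumFrom1 n f) (sumFrom1 n g) (f (suc n)) (g (suc n)))

sum-suc : ∀ n (f : ℕ → ℕ) → sumFrom1 n (λ r → suc (f r)) ≡ n + sumFrom1 n f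
sum-suc zero    f = refl
sum-suc (suc n) f = begin
  sumFrom1 n (suc ∘ f) + suc (f (suc n))    ≡⟨ cong (_+ suc (f (suc n))) (sum-suc n f) ⟩
  (n + sumFrom1 n f) + suc (f (suc n))      ≡⟨ +-suc (n + sumFrom1 n f) (f (suc n)) ⟩
  suc ((n + sumFrom1 n f) + f (suc n))      ≡⟨ cong suc (+-assoc n (sumFrom1 n f) (f (suc n))) ⟩
  suc (n + (sumFrom1 n f + f (suc n)))      ∎
  where open ≡-Reasoning

sum-skip : ∀ (h : ℕ → ℕ) a j → (∀ i → i < j → h (a + suc i) ≡ 0) →
           sumFrom1 (a + j) h ≡ sumFrom1 a h
sum-skip h a zero    vanish = cong (λ x → sumFrom1 x h) (+-identityʳ a)
sum-skip h a (suc j) vanish = begin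
  sumFrom1 (a + suc j) h                    ≡⟨ cong (λ x → sumFrom1 x h) (+-suc a j) ⟩
  sumFrom1 (a + j) h + h (suc (a + j))      ≡⟨ cong₂ _+_ skipped last ⟩
  sumFrom1 a h + 0                          ≡⟨ +-identityʳ _ ⟩
  sumFrom1 a h                              ∎
  where
  open ≡-Reasoning
  skipped : sumFrom1 (a + j) h ≡ sumFrom1 a h
  skipped = sum-skip h a j (λ i i<j → vanish i (m<n⇒m<1+n i<j))
  last : h (suc (a + j)) ≡ 0
  last = trans (cong h (sym (+-suc a j))) (vanish j (n<1+n j))

sum-multiples : ∀ q .{{_ : NonZero q}} (h : ℕ → ℕ) → (∀ r → ¬ q ∣ r → h r ≡ 0) →
                ∀ n → sumFrom1 n h ≡ sumFrom1 (n / q) (λ s → h (s * q))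
sum-multiples q@(suc q′) h vanish n = begin
  sumFrom1 n h                              ≡⟨ cong (λ x → sumFrom1 x h) n≡[n/q]q+[n%q] ⟩
  sumFrom1 (n / q * q + n % q) h            ≡⟨ sum-skip h (n / q * q) (n % q) tail-vanishes ⟩
  sumFrom1 (n / q * q) h                    ≡⟨ upto-multiple (n / q) ⟩
  sumFrom1 (n / q) (λ s → h (s * q))        ∎
  where
  open ≡-Reasoning
  offset-vanishes : ∀ m i → suc i < q → h (m * q + suc i) ≡ 0
  offset-vanishes m i i<q = vanish _ (λ q∣ → >⇒∤ i<q (∣m+n∣m⇒∣n q∣ (n∣m*n m)))

  -- The block (m·q, (m+1)·q] contributes only its last term h((m+1)·q).
  upto-multiple : ∀ m → sumFrom1 (m * q) h ≡ sumFrom1 m (λ s → h (s * q))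
  upto-multiple zero    = refl
  upto-multiple (suc m) = cong (_+ h (suc m * q)) (begin
    sumFrom1 (q′ + m * q) h                 ≡⟨ cong (λ x → sumFrom1 x h) (+-comm q′ (m * q)) ⟩
    sumFrom1 (m * q + q′) h                 ≡⟨ sum-skip h (m * q) q′ (λ i i<q′ → offset-vanishes m i (s≤s i<q′)) ⟩
    sumFrom1 (m * q) h                      ≡⟨ upto-multiple m ⟩
    sumFrom1 m (λ s → h (s * q))            ∎)

  n≡[n/q]q+[n%q] : n ≡ n / q * q + n % q
  n≡[n/q]q+[n%q] = trans (m≡m%n+[m/n]*n n q) (+-comm (n % q) (n / q * q))

  tail-vanishes : ∀ i → i < n % q → h (n / q * q + suc i) ≡ 0
  tail-vanishes i i<r = offset-vanishes (n / q) i (≤-trans (s≤s i<r) (m%n<n n q))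

module Base (k : ℕ) where

  q : ℕ
  q = suc (suc k)

  -- Division by q strictly decreases positive numbers; this bounds all fuel.
  /q-< : ∀ n .{{_ : NonZero n}} → n / q < n
  /q-< n = m/n<m n q (s≤s (s≤s z≤n))

  valAux-fuel : ∀ f g r → r ≤ f → r ≤ g → valAux q f r ≡ valAux q g r
  valAux-fuel zero    zero    zero    _         _         = refl
  valAux-fuel zero    (suc g) zero    _         _         = refl
  valAux-fuel (suc f) zero    zero    _         _         = refl
  valAux-fuel (suc f) (suc g) zero    _         _         = refl
  valAux-fuel (suc f) (suc g) (suc r) (s≤s r≤f) (s≤s r≤g) with q ∣? suc r
  ... | yes _ = cong suc (valAux-fuel f g (suc r / q) (≤-trans r/q≤r r≤f) (≤-trans r/q≤r r≤g))
    where
    r/q≤r : suc r / q ≤ r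
    r/q≤r = ≤-pred (/q-< (suc r))
  ... | no  _ = refl

  v-nondiv : ∀ r → ¬ q ∣ r → v q r ≡ 0
  v-nondiv zero    _   = refl
  v-nondiv (suc r) q∤r with q ∣? suc r
  ... | yes q∣r = ⊥-elim (q∤r q∣r)
  ... | no  _   = refl

  v-div : ∀ r → q ∣ suc r → v q (suc r) ≡ suc (v q (suc r / q))
  v-div r q∣r with q ∣? suc r
  ... | yes _   = cong suc (valAux-fuel r (suc r / q) (suc r / q) (≤-pred (/q-< (suc r))) ≤-refl)
  ... | no  q∤r = ⊥-elim (q∤r q∣r)

  v-mul : ∀ r .{{_ : NonZero r}} → v q (r * q) ≡ suc (v q r)
  v-mul r@(suc _) = trans (v-div _ (n∣m*n r)) (cong (suc ∘ v q) (m*n/n≡m r q))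

  v-coprime : Prime q → ∀ {a} → ¬ q ∣ a → ∀ s → v q (s * a) ≡ v q s
  v-coprime q-prime {a} q∤a = <-rec _ step
    where
    open ≡-Reasoning
    instance
      a≢0 : NonZero a
      a≢0 = ≢-nonZero (λ { refl → q∤a (q ∣0) })

    step : ∀ s → (∀ {t} → t < s → v q (t * a) ≡ v q t) → v q (s * a) ≡ v q s
    step zero      _   = refl
    step s@(suc _) rec = by-divisibility (q ∣? s)
      where
      by-divisibility : Dec (q ∣ s) → v q (s * a) ≡ v q s
      by-divisibility (no q∤s) = trans (v-nondiv (s * a) q∤sa) (sym (v-nondiv s q∤s))
        where
        q∤sa : ¬ q ∣ s * a
        q∤sa q∣sa = [ q∤s , q∤a ] (euclidsLemma s a q-prime q∣sa)
      by-divisibility (yes (divides t@(suc _) s≡tq)) = begin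
        v q (s * a)               ≡⟨ cong (λ x → v q (x * a)) s≡tq ⟩
        v q (t * q * a)           ≡⟨ cong (v q) (xy∙z≈xz∙y t q a) ⟩
        v q (t * a * q)           ≡⟨ v-mul (t * a) {{m*n≢0 t a}} ⟩
        suc (v q (t * a))         ≡⟨ cong suc (rec t<s) ⟩
        suc (v q t)               ≡⟨ sym (v-mul t) ⟩
        v q (t * q)               ≡⟨ cong (v q) (sym s≡tq) ⟩
        v q s                     ∎
        where
        t<s : t < s
        t<s = ≤-trans (m<m*n t q (s≤s (s≤s z≤n))) (≤-reflexive (sym s≡tq))

  legendre : ∀ n → sumFrom1 n (v q) ≡ n / q + sumFrom1 (n / q) (v q)
  legendre n = begin
    sumFrom1 n (v q)                        ≡⟨ sum-multiples q (v q) v-nondiv n ⟩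
    sumFrom1 (n / q) (λ s → v q (s * q))    ≡⟨ sum-cong (n / q) (λ s → v-mul (suc s)) ⟩
    sumFrom1 (n / q) (λ s → suc (v q s))    ≡⟨ sum-suc (n / q) (v q) ⟩
    n / q + sumFrom1 (n / q) (v q)          ∎
    where open ≡-Reasoning

  legendre-< : ∀ m → 1 ≤ m → sumFrom1 m (v q) < m
  legendre-< = <-rec _ step
    where
    step : ∀ m → (∀ {j} → j < m → 1 ≤ j → sumFrom1 j (v q) < j) →
           1 ≤ m → sumFrom1 m (v q) < m
    step m rec 1≤m with q ≤? m
    ... | no  q≰m = begin-strict
      sumFrom1 m (v q)                      ≡⟨ legendre m ⟩
      m / q + sumFrom1 (m / q) (v q)        ≡⟨ cong (λ j → j + sumFrom1 j (v q)) (m<n⇒m/n≡0 (≰⇒> q≰m)) ⟩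
      0                                     <⟨ 1≤m ⟩
      m                                     ∎
      where open ≤-Reasoning
    ... | yes q≤m = begin-strict
      sumFrom1 m (v q)                      ≡⟨ legendre m ⟩
      j + sumFrom1 j (v q)                  <⟨ +-monoʳ-< j (rec (/q-< m {{>-nonZero 1≤m}}) (m≥n⇒m/n>0 q≤m)) ⟩
      j + j                                 ≡⟨ cong (j +_) (sym (*-identityʳ j)) ⟩
      j + j * 1                             ≡⟨ sym (*-suc j 1) ⟩
      j * 2                                 ≤⟨ *-monoʳ-≤ j (s≤s (s≤s z≤n)) ⟩
      j * q                                 ≤⟨ m/n*n≤m m q ⟩
      m                                     ∎
      where
      open ≤-Reasoning
      j = m / q

  flogAux-fuel : ∀ f g n → n ≤ f → n ≤ g → flogAux q f n ≡ flogAux q g n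
  flogAux-fuel zero    zero    zero    _         _         = refl
  flogAux-fuel zero    (suc g) zero    _         _         = refl
  flogAux-fuel (suc f) zero    zero    _         _         = refl
  flogAux-fuel (suc f) (suc g) zero    _         _         = refl
  flogAux-fuel (suc f) (suc g) (suc n) (s≤s n≤f) (s≤s n≤g) with q ≤? suc n
  ... | yes _ = cong suc (flogAux-fuel f g (suc n / q) (≤-trans n/q≤n n≤f) (≤-trans n/q≤n n≤g))
    where
    n/q≤n : suc n / q ≤ n
    n/q≤n = ≤-pred (/q-< (suc n))
  ... | no  _ = refl

  flog-< : ∀ n → n < q → flog q n ≡ 0
  flog-< zero    _   = refl
  flog-< (suc n) n<q with q ≤? suc n
  ... | yes q≤n = ⊥-elim (<⇒≱ n<q q≤n)
  ... | no  _   = refl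

  flog-≥ : ∀ n → q ≤ n → flog q n ≡ suc (flog q (n / q))
  flog-≥ (suc n) q≤n with q ≤? suc n
  ... | yes _   = cong suc (flogAux-fuel n (suc n / q) (suc n / q) (≤-pred (/q-< (suc n))) ≤-refl)
  ... | no  q≰n = ⊥-elim (q≰n q≤n)

module OddBase (k : ℕ) (p-odd : ¬ 2 ∣ suc (suc k)) where

  open Base k using (/q-<; flog-<; flog-≥) renaming (legendre to legendreₚ; v-mul to v-mulₚ; v-nondiv to v-nondivₚ)
  open Base 0 using () renaming (legendre-< to legendre₂-<; v-coprime to v₂-coprime)

  p : ℕ
  p = suc (suc k)

  S : ℕ → ℕ
  S n = sumFrom1 n (v p)

  S₂ : ℕ → ℕ
  S₂ n = sumFrom1 n (λ r → v 2 r * v p r)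

  S₂-recursion : ∀ n → S₂ n ≡ sumFrom1 (n / p) (v 2) + S₂ (n / p)
  S₂-recursion n = begin
    S₂ n                                              ≡⟨ sum-multiples p h h-vanishes n ⟩
    sumFrom1 (n / p) (λ s → h (s * p))                ≡⟨ sum-cong (n / p) h-multiple ⟩
    sumFrom1 (n / p) (λ s → v 2 s + v 2 s * v p s)    ≡⟨ sum-+ (n / p) (v 2) (λ s → v 2 s * v p s) ⟩
    sumFrom1 (n / p) (v 2) + S₂ (n / p)               ∎
    where
    open ≡-Reasoning
    h : ℕ → ℕ
    h r = v 2 r * v p r

    h-vanishes : ∀ r → ¬ p ∣ r → h r ≡ 0
    h-vanishes r p∤r = trans (cong (v 2 r *_) (v-nondivₚ r p∤r)) (*-zeroʳ (v 2 r))

    h-multiple : ∀ s → h (suc s * p) ≡ v 2 (suc s) + v 2 (suc s) * v p (suc s)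
    h-multiple s = trans (cong₂ _*_ (v₂-coprime prime[2] p-odd (suc s)) (v-mulₚ (suc s)))
                         (*-suc (v 2 (suc s)) (v p (suc s)))

  main : ∀ n → S₂ n + flog p n ≤ S n
  main = <-rec _ step
    where
    open ≤-Reasoning
    step : ∀ n → (∀ {m} → m < n → S₂ m + flog p m ≤ S m) → S₂ n + flog p n ≤ S n
    step n rec with p ≤? n
    ... | yes p≤n = begin
      S₂ n + flog p n                         ≡⟨ cong₂ _+_ (S₂-recursion n) (flog-≥ n p≤n) ⟩
      (T m + S₂ m) + suc (flog p m)           ≡⟨ +-suc (T m + S₂ m) (flog p m) ⟩
      suc ((T m + S₂ m) + flog p m)           ≡⟨ cong suc (+-assoc (T m) (S₂ m) (flog p m)) ⟩
      suc (T m) + (S₂ m + flog p m)           ≤⟨ +-mono-≤ (legendre₂-< m (m≥n⇒m/n>0 p≤n)) (rec (/q-< n {{n≢0}})) ⟩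
      m + S m                                 ≡⟨ sym (legendreₚ n) ⟩
      S n                                     ∎
      where
      m : ℕ
      m = n / p
      T : ℕ → ℕ
      T j = sumFrom1 j (v 2)
      n≢0 : NonZero n
      n≢0 = >-nonZero (≤-trans (s≤s z≤n) p≤n)
    ... | no  p≰n = begin
      S₂ n + flog p n                         ≡⟨ cong₂ _+_ (S₂-recursion n) (flog-< n (≰⇒> p≰n)) ⟩
      (sumFrom1 (n / p) (v 2) + S₂ (n / p)) + 0
                                              ≡⟨ cong (λ m → (sumFrom1 m (v 2) + S₂ m) + 0) (m<n⇒m/n≡0 (≰⇒> p≰n)) ⟩
      0                                       ≤⟨ z≤n ⟩
      S n                                     ∎

theorem4 : (n p : ℕ) → 1 ≤ n → Prime p → ¬ (2 ∣ p) → .{{_ : NonZero p}} →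
    sumFrom1 n (λ r → v 2 r * v p r) + flog p n ≤ sumFrom1 n (λ r → v p r)
theorem4 n 0             _ p-prime _     = ⊥-elim (¬prime[0] p-prime)
theorem4 n 1             _ p-prime _     = ⊥-elim (¬prime[1] p-prime)
theorem4 n (suc (suc k)) _ _       p-odd = OddBase.main k p-odd n
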